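{- For every tree $T$ of order $n\ge 2$ and every integer $t\ge 1$, $S[T,t]$ is a tree and $\chi\big(S[T,t]\big)=2$.
   Context: Let $G$ be a simple graph with vertex set $V=\{1,\dots,n\}$, $n\ge 2$. For $t\ge 1$, the generalized Sierpiński graph $S(G,t)$ has vertex set $V^t$ (words $u_1u_2\cdots u_t$ over $V$), and two words ${\bf u}=u_1\cdots u_t$, ${\bf v}=v_1\cdots v_t$ are adjacent iff there is $i\in\{1,\dots,t\}$ with $u_j=v_j$ for $j<i$, $u_i\neq v_i$ and $u_iv_i\in E(G)$, and $u_j=v_i$, $v_j=u_i$ for all $j>i$. An edge of this kind with $i<t$ is called a linking edge. The generalized Sierpiński gasket $S[G,t]$ is the graph obtained from $S(G,t)$ by contracting all linking edges (so $S[G,1]=G$). $\chi$ denotes chromatic number. -}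

module Defs where

open import Data.Nat using (ℕ; zero; suc; _+_; _≤_)
import Data.Nat as ℕ
open import Data.Fin using (Fin; zero; suc; toℕ; inject₁; fromℕ)
import Data.Fin as F
open import Data.Vec using (Vec; lookup)
open import Data.Product using (Σ; ∃; _×_; _,_)
open import Data.Sum using (_⊎_)
open import Relation.Nullary using (¬_)
open import Relation.Binary using (Decidable)
open import Relation.Binary.PropositionalEquality using (_≡_; _≢_)
open import Relation.Binary.Construct.Closure.ReflexiveTransitive using (Star)

record Graph (n : ℕ) : Set₁ where
  field
    Adj    : Fin n → Fin n → Set
    adj?   : Decidable Adj
    sym    : ∀ {x y} → Adj x y → Adj y x
    irrefl : ∀ {x} → ¬ Adj x x
open Graph public

-- Graphs whose vertex set is given as a setoid (a type of
-- representatives together with an equivalence saying when two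
-- representatives denote the same vertex).  Needed since contraction
-- produces a quotient.

record SGraph : Set₁ where
  field
    V    : Set
    _≈_  : V → V → Set
    Adjˢ : V → V → Set


toSG : ∀ {n} → Graph n → SGraph
toSG {n} G = record { V = Fin n ; _≈_ = _≡_ ; Adjˢ = Adj G }

module _ (H : SGraph) where
  open SGraph H

  Connected : Set
  Connected = ∀ x y → Star (λ a b → (a ≈ b) ⊎ Adjˢ a b) x y

  -- a cycle of length m+3: pairwise distinct vertices c₀,…,c_{m+2}
  -- with c_i ~ c_{i+1} and c_{m+2} ~ c₀
  record Cycle (m : ℕ) : Set where
    field
      c        : Fin (suc (suc (suc m))) → V
      distinct : ∀ i j → c i ≈ c j → i ≡ j
      steps    : ∀ (i : Fin (suc (suc m))) → Adjˢ (c (inject₁ i)) (c (suc i))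
      closing  : Adjˢ (c (fromℕ (suc (suc m)))) (c zero)

  Acyclic : Set
  Acyclic = ∀ m → ¬ Cycle m

  IsTree : Set
  IsTree = Connected × Acyclic

  record Colouring (k : ℕ) : Set where
    field
      col      : V → Fin k
      wd       : ∀ {x y} → x ≈ y → col x ≡ col y
      proper   : ∀ {x y} → Adjˢ x y → col x ≢ col y

  ChromaticNumber : ℕ → Set
  ChromaticNumber k = Colouring k × (∀ m → m ℕ.< k → ¬ Colouring m)

Word : ℕ → ℕ → Set
Word n t = Vec (Fin n) t

module _ {n : ℕ} (G : Graph n) {t : ℕ} where

  SAdjAt : Word n t → Word n t → Fin t → Set
  SAdjAt u v i =
      (∀ j → j F.< i → lookup u j ≡ lookup v j)
    × (lookup u i ≢ lookup v i)
    × Adj G (lookup u i) (lookup v i)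
    × (∀ j → i F.< j → (lookup u j ≡ lookup v i) × (lookup v j ≡ lookup u i))

  SAdj : Word n t → Word n t → Set
  SAdj u v = ∃ λ i → SAdjAt u v i

  -- linking edges: i < t (1-based), i.e. toℕ i + 1 < t (0-based)
  LinkAdj : Word n t → Word n t → Set
  LinkAdj u v = ∃ λ i → (suc (toℕ i) ℕ.< t) × SAdjAt u v i

  -- identification produced by contracting all linking edges
  Contracted : Word n t → Word n t → Set
  Contracted = Star LinkAdj

  GAdj : Word n t → Word n t → Set
  GAdj u v = ¬ Contracted u v
    × ∃ λ u' → ∃ λ v' → Contracted u u' × Contracted v v' × SAdj u' v'

Sierpinski : ∀ {n} → Graph n → ℕ → SGraph
Sierpinski {n} G t = record { V = Word n t ; _≈_ = _≡_ ; Adjˢ = SAdj G }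

Gasket : ∀ {n} → Graph n → ℕ → SGraph
Gasket {n} G t = record { V = Word n t ; _≈_ = Contracted G ; Adjˢ = GAdj G }

{-# OPTIONS --safe #-}
module Submission where

-- Root the tree T at a vertex a.  Breadth-first search gives every vertex its distance from a
-- and a parent, and as T is acyclic every edge of T joins a vertex to its parent.  This lifts
-- to S[T,t+1] rooted at aᵗ⁺¹: a word x w lies in the copy of S[T,t] labelled x, which is entered
-- through the vertex it shares with the copy of the parent of x, so the level of x w is the
-- level of that entry vertex plus the level of w in the copy, rooted at the parent of x; parents
-- of words are defined in the same way.  Again every edge of the gasket joins a vertex to its
-- parent, one level below it.  Such a levelling rules out cycles (the two cycle-neighbours of a
-- vertex of maximal level would both be its parent), and the parity of the level is a proper
-- 2-colouring.  Connectivity is inherited from S(T,t+1).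

open import Defs hiding (sym)
open import Data.Empty using (⊥; ⊥-elim)
open import Data.Fin using (Fin; zero; suc; toℕ; inject₁; fromℕ; _≟_)
open import Data.Fin.Properties using (¬Fin0; any?; inject₁ℕ<; toℕ-fromℕ)
import Data.Fin.Properties as Fin
open import Data.Fin.Relation.Unary.Top using (view; ‵fromℕ; ‵inj₁)
open import Data.List using (allFin)
open import Data.List.Extrema.Nat using (argmax; f[xs]≤f[argmax])
open import Data.List.Membership.Propositional.Properties using (∈-allFin)
import Data.List.Relation.Unary.All as All
open import Data.Nat using (ℕ; zero; suc; _+_; _≤_; _<_; z≤n; s≤s)
open import Data.Nat.Induction using (<-rec)
open import Data.Nat.Properties
  using ( anyUpTo?; ≮⇒≥; ≤-antisym; ≤-reflexive; ≤-refl; ≤-trans; ≤-pred; n≤1+n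
        ; <⇒≤; <⇒≢; <-cmp; 1+n≰n; 1+n≢n; 0≢1+n; suc-injective; +-identityʳ; +-suc)
open import Data.Product using (∃; ∃₂; _×_; _,_; proj₁; proj₂; swap)
open import Data.Sum using (_⊎_; inj₁; inj₂)
import Data.Sum as Sum
open import Data.Vec using (Vec; []; _∷_; lookup; replicate; head)
open import Data.Vec.Functional as V using (Vector)
import Data.Vec.Properties as Vec
open import Function using (_∘_; _on_)
open import Function.Definitions using (Injective)
open import Relation.Binary using (IsEquivalence; tri<; tri≈; tri>)
open import Relation.Binary.PropositionalEquality
  using (_≡_; _≢_; refl; sym; trans; cong; cong₂; subst; subst₂)
open import Relation.Binary.Construct.Closure.ReflexiveTransitive using (Star; ε; _◅_; _◅◅_)
import Relation.Binary.Construct.Closure.ReflexiveTransitive as Star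
open import Relation.Nullary using (¬_; Dec; yes; no; contradiction)
open import Relation.Nullary.Decidable using (_×-dec_)
import Relation.Unary as U

parity : ℕ → Fin 2
parity zero = zero
parity (suc zero) = suc zero
parity (suc (suc k)) = parity k

parity-suc : ∀ k → parity (suc k) ≢ parity k
parity-suc zero ()
parity-suc (suc zero) ()
parity-suc (suc (suc k)) = parity-suc k

Least : (ℕ → Set) → ℕ → Set
Least P k = P k × ∀ {j} → P j → k ≤ j

least : ∀ {P : ℕ → Set} → U.Decidable P → ∀ {B} → P B → ∃ (Least P)
least {P} P? {B} = <-rec (λ B → P B → ∃ (Least P)) search B
  where
  search : ∀ B → (∀ {C} → C < B → P C → ∃ (Least P)) → P B → ∃ (Least P)
  search B smaller pB with anyUpTo? P? B
  ... | yes (_ , C<B , pC) = smaller C<B pC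
  ... | no none = B , pB , λ pj → ≮⇒≥ λ j<B → none (_ , j<B , pj)

inject₁²≢suc² : ∀ {k} (i : Fin k) → inject₁ (inject₁ i) ≢ suc (suc i)
inject₁²≢suc² zero ()
inject₁²≢suc² (suc i) = inject₁²≢suc² i ∘ Fin.suc-injective

lookup-const⇒replicate : ∀ {A : Set} {t} (u : Vec A t) {y} →
                         (∀ j → lookup u j ≡ y) → u ≡ replicate t y
lookup-const⇒replicate [] _ = refl
lookup-const⇒replicate (x ∷ u) u≡y =
  cong₂ _∷_ (u≡y zero) (lookup-const⇒replicate u (u≡y ∘ suc))

Walk : ∀ {n} → Graph n → Fin n → Fin n → Set
Walk G = Star (λ x y → x ≡ y ⊎ Adj G x y)

walk⇒edge : ∀ {n} (G : Graph n) {x y} → x ≢ y → Walk G x y → ∃₂ (Adj G)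
walk⇒edge G x≢y ε = contradiction refl x≢y
walk⇒edge G x≢y (inj₁ refl ◅ w) = walk⇒edge G x≢y w
walk⇒edge G x≢y (inj₂ xz ◅ w) = _ , _ , xz

-- Levelled graphs

module _ (H : SGraph) where
  open SGraph H

  ParentEdge : (V → ℕ) → (V → V) → V → V → Set
  ParentEdge level parent x y = level y ≡ suc (level x) × x ≈ parent y

  record Levelled : Set where
    field
      level          : V → ℕ
      parent         : V → V
      level-cong     : ∀ {x y} → x ≈ y → level x ≡ level y
      adj⇒parentEdge : ∀ {x y} → Adjˢ x y →
                       ParentEdge level parent x y ⊎ ParentEdge level parent y x

  Incident : V → V → Set
  Incident x y = Adjˢ x y ⊎ Adjˢ y x

  module _ {m} (C : Cycle H m) where
    open Cycle C

    cycle-neighbours : ∀ k → ∃₂ λ p q → p ≢ q × Incident (c p) (c k) × Incident (c q) (c k)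
    cycle-neighbours zero = suc zero , fromℕ _ , (λ ()) , inj₂ (steps zero) , inj₁ closing
    cycle-neighbours (suc j) with view j
    ... | ‵fromℕ = inject₁ j , zero , (λ ()) , inj₁ (steps j) , inj₂ closing
    ... | ‵inj₁ {i = i} _ =
      inject₁ j , suc (suc i) , inject₁²≢suc² i , inj₁ (steps j) , inj₂ (steps (suc i))

  module _ (L : Levelled) where
    open Levelled L

    lower-neighbour : ∀ {x y} → level y ≤ level x → Incident y x → y ≈ parent x
    lower-neighbour {x} y≤x (inj₁ yx) with adj⇒parentEdge yx
    ... | inj₁ (_ , y≈px) = y≈px
    ... | inj₂ (y≡1+x , _) = contradiction (subst (_≤ level x) y≡1+x y≤x) 1+n≰n
    lower-neighbour {x} y≤x (inj₂ xy) with adj⇒parentEdge xy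
    ... | inj₁ (y≡1+x , _) = contradiction (subst (_≤ level x) y≡1+x y≤x) 1+n≰n
    ... | inj₂ (_ , y≈px) = y≈px

    Levelled⇒Acyclic : IsEquivalence _≈_ → Acyclic H
    Levelled⇒Acyclic ≈-equiv m C = two-parents (cycle-neighbours C top)
      where
      open Cycle C
      open IsEquivalence ≈-equiv using () renaming (sym to ≈-sym; trans to ≈-trans)
      top : Fin (suc (suc (suc m)))
      top = argmax (level ∘ c) zero (allFin _)
      maximal : ∀ i → level (c i) ≤ level (c top)
      maximal i = All.lookup (f[xs]≤f[argmax] {f = level ∘ c} zero (allFin _)) (∈-allFin i)
      two-parents : ¬ ∃₂ λ p q → p ≢ q × Incident (c p) (c top) × Incident (c q) (c top)
      two-parents (p , q , p≢q , p~top , q~top) =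
        p≢q (distinct p q (≈-trans (lower-neighbour (maximal p) p~top)
                                   (≈-sym (lower-neighbour (maximal q) q~top))))

    Levelled⇒Colouring : Colouring H 2
    Levelled⇒Colouring = record
      { col = parity ∘ level
      ; wd = cong parity ∘ level-cong
      ; proper = proper }
      where
      proper : ∀ {x y} → Adjˢ x y → parity (level x) ≢ parity (level y)
      proper {x} {y} xy with adj⇒parentEdge xy
      ... | inj₁ (y≡1+x , _) = λ e → parity-suc (level x) (trans (cong parity (sym y≡1+x)) (sym e))
      ... | inj₂ (x≡1+y , _) = λ e → parity-suc (level y) (trans (cong parity (sym x≡1+y)) e)

  monochromatic : (i j : Fin 1) → i ≢ j → ⊥
  monochromatic zero zero i≢j = i≢j refl

  χ≡2 : ∃₂ Adjˢ → Colouring H 2 → ChromaticNumber H 2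
  χ≡2 (x , y , xy) colouring = colouring , λ where
    zero _ k → ¬Fin0 (Colouring.col k x)
    (suc zero) _ k → monochromatic (Colouring.col k x) (Colouring.col k y) (Colouring.proper k xy)
    (suc (suc _)) (s≤s (s≤s ()))

-- Breadth-first search in a tree

module _ {A : Set} where

  Linked : ∀ {k} → (A → A → Set) → Vector A (suc k) → Set
  Linked R f = ∀ i → R (f (inject₁ i)) (f (suc i))

  _∷ʳ_ : ∀ {k} → Vector A (suc k) → A → Vector A (suc (suc k))
  (f ∷ʳ q) zero = f zero
  _∷ʳ_ {zero} f q (suc zero) = q
  _∷ʳ_ {suc k} f q (suc i) = (V.tail f ∷ʳ q) i

  ∷ʳ-inject₁ : ∀ {k} (f : Vector A (suc k)) q i → (f ∷ʳ q) (inject₁ i) ≡ f i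
  ∷ʳ-inject₁ f q zero = refl
  ∷ʳ-inject₁ {suc k} f q (suc i) = ∷ʳ-inject₁ (V.tail f) q i

  ∷ʳ-last : ∀ {k} (f : Vector A (suc k)) q → (f ∷ʳ q) (fromℕ (suc k)) ≡ q
  ∷ʳ-last {zero} f q = refl
  ∷ʳ-last {suc k} f q = ∷ʳ-last (V.tail f) q

  ∷ʳ-all : ∀ {k} (P : A → Set) {f : Vector A (suc k)} {q} →
           (∀ i → P (f i)) → P q → ∀ i → P ((f ∷ʳ q) i)
  ∷ʳ-all P {f} {q} pf pq i with view i
  ... | ‵fromℕ = subst P (sym (∷ʳ-last f q)) pq
  ... | ‵inj₁ {i = j} _ = subst P (sym (∷ʳ-inject₁ f q j)) (pf j)

  ∷ʳ-linked : ∀ {k} {R : A → A → Set} {f : Vector A (suc k)} {q} →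
              Linked R f → R (f (fromℕ k)) q → Linked R (f ∷ʳ q)
  ∷ʳ-linked {R = R} {f} {q} lf rq i with view i
  ... | ‵fromℕ = subst₂ R (sym (∷ʳ-inject₁ f q (fromℕ _))) (sym (∷ʳ-last f q)) rq
  ... | ‵inj₁ {i = j} _ =
    subst₂ R (sym (∷ʳ-inject₁ f q (inject₁ j))) (sym (∷ʳ-inject₁ f q (suc j))) (lf j)

  injective-[-] : ∀ (f : Vector A 1) → Injective _≡_ _≡_ f
  injective-[-] f {zero} {zero} _ = refl

  injective-∷ : ∀ {k} {p} {f : Vector A k} → (∀ i → p ≢ f i) → Injective _≡_ _≡_ f →
                Injective _≡_ _≡_ (p V.∷ f)
  injective-∷ p∉f inj {zero} {zero} _ = refl
  injective-∷ p∉f inj {zero} {suc j} e = contradiction e (p∉f j)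
  injective-∷ p∉f inj {suc i} {zero} e = contradiction (sym e) (p∉f i)
  injective-∷ p∉f inj {suc i} {suc j} e = cong suc (inj e)

  injective-∷ʳ : ∀ {k} {f : Vector A (suc k)} {q} → Injective _≡_ _≡_ f → (∀ i → f i ≢ q) →
                 Injective _≡_ _≡_ (f ∷ʳ q)
  injective-∷ʳ {f = f} {q} inj f∌q {i} {j} e with view i | view j
  ... | ‵fromℕ | ‵fromℕ = refl
  ... | ‵fromℕ | ‵inj₁ {i = j′} _ =
    contradiction (trans (sym (∷ʳ-inject₁ f q j′)) (trans (sym e) (∷ʳ-last f q))) (f∌q j′)
  ... | ‵inj₁ {i = i′} _ | ‵fromℕ =
    contradiction (trans (sym (∷ʳ-inject₁ f q i′)) (trans e (∷ʳ-last f q))) (f∌q i′)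
  ... | ‵inj₁ {i = i′} _ | ‵inj₁ {i = j′} _ =
    cong inject₁ (inj (trans (sym (∷ʳ-inject₁ f q i′)) (trans e (∷ʳ-inject₁ f q j′))))

module BFS {n} (T : Graph n) (conn : Connected (toSG T)) (acyc : Acyclic (toSG T)) (a : Fin n) where

  data Reach : ℕ → Fin n → Set where
    here : Reach zero a
    step : ∀ {k x y} → Reach k x → Adj T x y → Reach (suc k) y

  reach? : ∀ k x → Dec (Reach k x)
  reach? zero x with x ≟ a
  ... | yes refl = yes here
  ... | no x≢a = no λ { here → x≢a refl }
  reach? (suc k) y with any? (λ x → reach? k x ×-dec adj? T x y)
  ... | yes (x , r , xy) = yes (step r xy)
  ... | no none = no λ { (step r xy) → none (_ , r , xy) }

  reach-walk : ∀ {k x y} → Reach k x → Walk T x y → ∃ λ l → Reach l y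
  reach-walk r ε = _ , r
  reach-walk r (inj₁ refl ◅ w) = reach-walk r w
  reach-walk r (inj₂ xy ◅ w) = reach-walk (step r xy) w

  dist-least : ∀ x → ∃ (Least λ k → Reach k x)
  dist-least x = least (λ k → reach? k x) (proj₂ (reach-walk here (conn a x)))

  dist : Fin n → ℕ
  dist x = proj₁ (dist-least x)

  dist-reach : ∀ x → Reach (dist x) x
  dist-reach x = proj₁ (proj₂ (dist-least x))

  dist-minimal : ∀ {k x} → Reach k x → dist x ≤ k
  dist-minimal {x = x} = proj₂ (proj₂ (dist-least x))

  dist-root : dist a ≡ 0
  dist-root = ≤-antisym (dist-minimal here) z≤n

  dist≡0⇒root : ∀ {x} → dist x ≡ 0 → x ≡ a
  dist≡0⇒root {x} d≡0 = reach₀ (subst (λ k → Reach k x) d≡0 (dist-reach x))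
    where
    reach₀ : ∀ {x} → Reach 0 x → x ≡ a
    reach₀ here = refl

  dist-suc⇒≢root : ∀ {x L} → dist x ≡ suc L → x ≢ a
  dist-suc⇒≢root d refl with trans (sym dist-root) d
  ... | ()

  dist-adj : ∀ {x y} → Adj T x y → dist y ≤ suc (dist x)
  dist-adj xy = dist-minimal (step (dist-reach _) xy)

  predecessor : ∀ {x} → x ≢ a → ∃ λ y → Adj T y x × dist x ≡ suc (dist y)
  predecessor x≢a = last-step x≢a (dist-reach _) refl
    where
    last-step : ∀ {k x} → x ≢ a → Reach k x → k ≡ dist x →
                ∃ λ y → Adj T y x × dist x ≡ suc (dist y)
    last-step x≢a here _ = contradiction refl x≢a
    last-step _ (step {x = y} r yx) 1+k≡dx =
      y , yx , ≤-antisym (dist-adj yx) (subst (suc (dist y) ≤_) 1+k≡dx (s≤s (dist-minimal r)))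

  parent : Fin n → Fin n
  parent x with x ≟ a
  ... | yes _ = a
  ... | no x≢a = proj₁ (predecessor x≢a)

  parent-root : parent a ≡ a
  parent-root with a ≟ a
  ... | yes _ = refl
  ... | no a≢a = contradiction refl a≢a

  parent-spec : ∀ {x} → x ≢ a → Adj T (parent x) x × dist x ≡ suc (dist (parent x))
  parent-spec {x} x≢a with x ≟ a
  ... | yes x≡a = contradiction x≡a x≢a
  ... | no x≢a′ = proj₂ (predecessor x≢a′)

  dist-parent : ∀ x → dist (parent x) ≤ dist x
  dist-parent x = by-cases (x ≟ a)
    where
    by-cases : Dec (x ≡ a) → dist (parent x) ≤ dist x
    by-cases (yes x≡a) =
      subst (λ z → dist (parent z) ≤ dist z) (sym x≡a) (≤-reflexive (cong dist parent-root))
    by-cases (no x≢a) = ≤-trans (n≤1+n _) (≤-reflexive (sym (proj₂ (parent-spec x≢a))))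

  -- Replacing both endpoints by their parents keeps such a path injective, as the parents lie
  -- below it, and closes it into a cycle as soon as the two parents coincide; at level 0 both
  -- endpoints would be the root.
  ¬level-path : ∀ L {k} (f : Vector (Fin n) (suc (suc k))) →
                Injective _≡_ _≡_ f → Linked (Adj T) f → (∀ i → L ≤ dist (f i)) →
                dist (f zero) ≡ L → dist (f (fromℕ (suc k))) ≡ L → ⊥
  ¬level-path zero f inj _ _ d₀ d₁ =
    Fin.0≢1+n (inj (trans (dist≡0⇒root d₀) (sym (dist≡0⇒root d₁))))
  ¬level-path (suc L) {k} f inj lnk above d₀ d₁
    with parent-spec (dist-suc⇒≢root d₀) | parent-spec (dist-suc⇒≢root d₁)
  ... | pf , dp | qf , dq = climb (p ≟ q)
    where
    p q : Fin n
    p = parent (f zero)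
    q = parent (f (fromℕ (suc k)))
    dpL : dist p ≡ L
    dpL = suc-injective (trans (sym dp) d₀)
    dqL : dist q ≡ L
    dqL = suc-injective (trans (sym dq) d₁)
    below : ∀ {v} → dist v ≡ L → ∀ i → v ≢ f i
    below dv i refl = 1+n≰n (subst (suc L ≤_) dv (above i))
    longer : Vector (Fin n) (suc (suc (suc (suc k))))
    longer = p V.∷ (f ∷ʳ q)
    longer-linked : Linked (Adj T) longer
    longer-linked zero = pf
    longer-linked (suc i) = ∷ʳ-linked {R = Adj T} {f} lnk (Graph.sym T qf) i
    longer-above : ∀ i → L ≤ dist (longer i)
    longer-above zero = ≤-reflexive (sym dpL)
    longer-above (suc i) =
      ∷ʳ-all (λ v → L ≤ dist v) (λ j → ≤-trans (n≤1+n L) (above j)) (≤-reflexive (sym dqL)) i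
    climb : Dec (p ≡ q) → ⊥
    climb (yes p≡q) = acyc k record
      { c = p V.∷ f
      ; distinct = λ _ _ → injective-∷ (below dpL) inj
      ; steps = λ { zero → pf ; (suc i) → lnk i }
      ; closing = Graph.sym T (subst (λ z → Adj T z (f (fromℕ (suc k)))) (sym p≡q) qf) }
    climb (no p≢q) =
      ¬level-path L longer
        (injective-∷ (∷ʳ-all (p ≢_) (below dpL) p≢q) (injective-∷ʳ inj (λ i → below dqL i ∘ sym)))
        longer-linked longer-above dpL (trans (cong dist (∷ʳ-last f q)) dqL)

  child : ∀ {x y} → Adj T x y → dist x < dist y → ParentEdge (toSG T) dist parent x y
  child {x} {y} xy x<y = from-parent (parent-spec (dist-suc⇒≢root y≡1+x)) (parent y ≟ x)
    where
    y≡1+x : dist y ≡ suc (dist x)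
    y≡1+x = ≤-antisym (dist-adj xy) x<y
    from-parent : Adj T (parent y) y × dist y ≡ suc (dist (parent y)) → Dec (parent y ≡ x) →
                  ParentEdge (toSG T) dist parent x y
    from-parent _ (yes py≡x) = y≡1+x , sym py≡x
    from-parent (py-y , dpy) (no py≢x) =
      ⊥-elim (¬level-path (dist x) path inj linked above (suc-injective (trans (sym dpy) y≡1+x)) refl)
      where
      path : Vector (Fin n) 3
      path = parent y V.∷ y V.∷ x V.∷ V.[]
      inj : Injective _≡_ _≡_ path
      inj = injective-∷ (λ { zero → <⇒≢ (≤-reflexive (sym dpy)) ∘ cong dist ; (suc zero) → py≢x })
              (injective-∷ (λ { zero → <⇒≢ x<y ∘ cong dist ∘ sym }) (injective-[-] _))
      linked : Linked (Adj T) path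
      linked zero = py-y
      linked (suc zero) = Graph.sym T xy
      above : ∀ i → dist x ≤ dist (path i)
      above zero = ≤-reflexive (suc-injective (trans (sym y≡1+x) dpy))
      above (suc zero) = <⇒≤ x<y
      above (suc (suc zero)) = ≤-refl

  adj⇒parentEdge : ∀ {x y} → Adj T x y →
                   ParentEdge (toSG T) dist parent x y ⊎ ParentEdge (toSG T) dist parent y x
  adj⇒parentEdge {x} {y} xy with <-cmp (dist x) (dist y)
  ... | tri< x<y _ _ = inj₁ (child xy x<y)
  ... | tri> _ _ y<x = inj₂ (child (Graph.sym T xy) y<x)
  ... | tri≈ _ x≡y _ = ⊥-elim (¬level-path (dist x) path inj (λ { zero → xy }) above refl (sym x≡y))
    where
    path : Vector (Fin n) 2
    path = x V.∷ y V.∷ V.[]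
    inj : Injective _≡_ _≡_ path
    inj = injective-∷ (λ { zero refl → Graph.irrefl T xy }) (injective-[-] _)
    above : ∀ i → dist x ≤ dist (path i)
    above zero = ≤-refl
    above (suc zero) = ≤-reflexive x≡y

-- Adjacency in S(G,t)

module _ {n} (G : Graph n) where

  SAdjAt-sym : ∀ {t} {u v : Word n t} {i} → SAdjAt G u v i → SAdjAt G v u i
  SAdjAt-sym (pre , ne , uv , post) =
    (λ j j<i → sym (pre j j<i)) , ne ∘ sym , Graph.sym G uv , (λ j i<j → swap (post j i<j))

  LinkAdj-sym : ∀ {t} {u v : Word n t} → LinkAdj G u v → LinkAdj G v u
  LinkAdj-sym {u = u} {v} (i , lt , s) = i , lt , SAdjAt-sym {u = u} {v} s

  Contracted-isEquivalence : ∀ {t} → IsEquivalence (Contracted G {t})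
  Contracted-isEquivalence = record
    { refl = ε
    ; sym = Star.reverse (λ {u} {v} → LinkAdj-sym {u = u} {v})
    ; trans = _◅◅_ }

  ∷-SAdjAt : ∀ {t} {u v : Word n t} {i} x → SAdjAt G u v i → SAdjAt G (x ∷ u) (x ∷ v) (suc i)
  ∷-SAdjAt x (pre , ne , uv , post) =
    (λ { zero _ → refl ; (suc j) (s≤s j<i) → pre j j<i }) , ne , uv ,
    (λ { zero () ; (suc j) (s≤s i<j) → post j i<j })

  SAdjAt-∷⁻ : ∀ {t} {u v : Word n t} {x y i} → SAdjAt G (x ∷ u) (y ∷ v) (suc i) →
              x ≡ y × SAdjAt G u v i
  SAdjAt-∷⁻ (pre , ne , uv , post) =
    pre zero (s≤s z≤n) ,
    (λ j j<i → pre (suc j) (s≤s j<i)) , ne , uv , (λ j i<j → post (suc j) (s≤s i<j))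

  SAdjAt-head⁺ : ∀ {t x y} → Adj G x y → SAdjAt G (x ∷ replicate t y) (y ∷ replicate t x) zero
  SAdjAt-head⁺ {x = x} {y} xy =
    (λ _ ()) , (λ { refl → Graph.irrefl G xy }) , xy ,
    (λ { zero () ; (suc j) _ → Vec.lookup-replicate j y , Vec.lookup-replicate j x })

  SAdjAt-head⁻ : ∀ {t} {u v : Word n t} {x y} → SAdjAt G (x ∷ u) (y ∷ v) zero →
                 Adj G x y × u ≡ replicate t y × v ≡ replicate t x
  SAdjAt-head⁻ {u = u} {v} (_ , _ , xy , post) =
    xy , lookup-const⇒replicate u (λ j → proj₁ (post (suc j) (s≤s z≤n))) ,
         lookup-const⇒replicate v (λ j → proj₂ (post (suc j) (s≤s z≤n)))

  ∷-Contracted : ∀ {t} {u v : Word n t} x → Contracted G u v → Contracted G (x ∷ u) (x ∷ v)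
  ∷-Contracted x = Star.gmap (x ∷_) λ (i , lt , s) → suc i , s≤s lt , ∷-SAdjAt x s

  -- The last letter of u is v_i, which differs from u_i.
  LinkAdj⇒≢replicate : ∀ {t} {u v : Word n (suc t)} → LinkAdj G u v → ∀ c → u ≢ replicate (suc t) c
  LinkAdj⇒≢replicate {t} (i , lt , _ , ne , _ , post) c refl =
    ne (trans (Vec.lookup-replicate i c)
              (trans (sym (Vec.lookup-replicate (fromℕ t) c)) (proj₁ (post (fromℕ t) i<last))))
    where
    i<last : toℕ i < toℕ (fromℕ t)
    i<last = subst (toℕ i <_) (sym (toℕ-fromℕ t)) (≤-pred lt)

  ¬LinkAdj-[-] : {u v : Word n 1} → ¬ LinkAdj G u v
  ¬LinkAdj-[-] (_ , s≤s () , _)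

  data LinkView {t} : Word n (suc (suc t)) → Word n (suc (suc t)) → Set where
    at-head : ∀ {x y} → Adj G x y → LinkView (x ∷ replicate (suc t) y) (y ∷ replicate (suc t) x)
    in-tail : ∀ {x} {u v : Word n (suc t)} → LinkAdj G u v → LinkView (x ∷ u) (x ∷ v)

  linkView : ∀ {t} {u v : Word n (suc (suc t))} → LinkAdj G u v → LinkView u v
  linkView {u = x ∷ u} {y ∷ v} (zero , _ , s) with SAdjAt-head⁻ {u = u} {v} s
  ... | xy , refl , refl = at-head xy
  linkView {u = x ∷ u} {y ∷ v} (suc i , s≤s lt , s) with SAdjAt-∷⁻ {u = u} {v} s
  ... | refl , s′ = in-tail (i , lt , s′)

  linking-or-last : ∀ {t} {u v : Word n (suc t)} → SAdj G u v →
                    LinkAdj G u v ⊎ SAdjAt G u v (fromℕ t)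
  linking-or-last (i , s) with view i
  ... | ‵fromℕ = inj₂ s
  ... | ‵inj₁ {i = j} _ = inj₁ (inject₁ j , s≤s (inject₁ℕ< j) , s)

  ∃-last-SAdjAt : ∀ {x y} → Adj G x y → ∀ t →
                  ∃₂ λ (u v : Word n (suc t)) → SAdjAt G u v (fromℕ t)
  ∃-last-SAdjAt {x} {y} xy zero = x ∷ [] , y ∷ [] , SAdjAt-head⁺ xy
  ∃-last-SAdjAt {x} xy (suc t) with ∃-last-SAdjAt xy t
  ... | u , v , s = x ∷ u , x ∷ v , ∷-SAdjAt x s

  Sierpinski-connected : Connected (toSG G) → ∀ t → Connected (Sierpinski G t)
  Sierpinski-connected conn zero [] [] = ε
  Sierpinski-connected conn (suc t) (x ∷ u) (y ∷ v) = across (conn x y) u v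
    where
    Step : Word n (suc t) → Word n (suc t) → Set
    Step u v = u ≡ v ⊎ SAdj G u v
    within : ∀ x (u v : Word n t) → Star Step (x ∷ u) (x ∷ v)
    within x u v = Star.gmap (x ∷_) (Sum.map (cong (x ∷_)) λ (i , s) → suc i , ∷-SAdjAt x s)
                     (Sierpinski-connected conn t u v)
    across : ∀ {x y} → Walk G x y → ∀ u v → Star Step (x ∷ u) (y ∷ v)
    across {x} ε u v = within x u v
    across (inj₁ refl ◅ w) u v = across w u v
    across {x} (_◅_ {j = z} (inj₂ xz) w) u v =
      within x u (replicate t z) ◅◅ inj₂ (zero , SAdjAt-head⁺ xz) ◅ across w (replicate t x) v

-- The gasket of a tree

module GasketOfTree {n} (T : Graph n) (conn : Connected (toSG T)) (acyc : Acyclic (toSG T)) where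
  open BFS T conn acyc using (dist; parent; dist-root; parent-root; dist-parent; adj⇒parentEdge)
  open module Contracted-≈ {t} = IsEquivalence (Contracted-isEquivalence T {t})
    using () renaming (reflexive to ≈-reflexive; sym to ≈-sym; trans to ≈-trans)

  mutual
    gdist : ∀ t → Fin n → Word n (suc t) → ℕ
    gdist zero a (x ∷ []) = dist a x
    gdist (suc t) a (x ∷ w) = entryDist t a (dist a x) x + gdist t (parent a x) w

    -- entryDist t a (dist a x) x is the gdist of x (parent a x)ᵗ⁺¹, the vertex through which the
    -- copy of x is entered from the copy of parent a x; the ℕ argument is fuel.
    entryDist : ∀ t → Fin n → ℕ → Fin n → ℕ
    entryDist t a zero x = 0
    entryDist t a (suc k) x =
      entryDist t a k (parent a x) + gdist t (parent a (parent a x)) (replicate (suc t) x)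

  -- The entry vertex of a copy is contracted with a vertex of the parent copy, where its parent lies.
  gparent : ∀ t → Fin n → Word n (suc t) → Word n (suc t)
  gparent zero a (x ∷ []) = parent a x ∷ []
  gparent (suc t) a (x ∷ w) with Vec.≡-dec _≟_ w (replicate (suc t) (parent a x))
  ... | yes _ = parent a x ∷ gparent t (parent a (parent a x)) (replicate (suc t) x)
  ... | no _ = x ∷ gparent t (parent a x) w

  gparent-at-entry : ∀ t a x → gparent (suc t) a (x ∷ replicate (suc t) (parent a x))
                             ≡ parent a x ∷ gparent t (parent a (parent a x)) (replicate (suc t) x)
  gparent-at-entry t a x with Vec.≡-dec _≟_ entry entry
    where entry = replicate (suc t) (parent a x)
  ... | yes _ = refl
  ... | no ≢ = contradiction refl ≢

  gparent-off-entry : ∀ t a x {w} → w ≢ replicate (suc t) (parent a x) →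
                      gparent (suc t) a (x ∷ w) ≡ x ∷ gparent t (parent a x) w
  gparent-off-entry t a x {w} w≢ with Vec.≡-dec _≟_ w (replicate (suc t) (parent a x))
  ... | yes w≡ = contradiction w≡ w≢
  ... | no _ = refl

  gdist-root : ∀ t a → gdist t a (replicate (suc t) a) ≡ 0
  gdist-root zero a = dist-root a
  gdist-root (suc t) a rewrite dist-root a | parent-root a = gdist-root t a

  module _ (t : ℕ) (a y : Fin n) (y≡1+py : dist a y ≡ suc (dist a (parent a y))) where

    gdist-link-head : gdist (suc t) a (y ∷ replicate (suc t) (parent a y))
                    ≡ gdist (suc t) a (parent a y ∷ replicate (suc t) y)
    gdist-link-head rewrite y≡1+py | gdist-root t (parent a y) = +-identityʳ _

    gparent-link-head : gparent (suc t) a (y ∷ replicate (suc t) (parent a y))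
                      ≡ gparent (suc t) a (parent a y ∷ replicate (suc t) y)
    gparent-link-head =
      trans (gparent-at-entry t a y) (sym (gparent-off-entry t a (parent a y) (y≢ppy ∘ cong head)))
      where
      y≢ppy : y ≢ parent a (parent a y)
      y≢ppy y≡ppy =
        <⇒≢ (s≤s (dist-parent a (parent a y))) (trans (cong (dist a) (sym y≡ppy)) y≡1+py)

  gdist-link : ∀ t a {u v : Word n (suc t)} → LinkAdj T u v → gdist t a u ≡ gdist t a v
  gdist-link zero a {u} {v} l = ⊥-elim (¬LinkAdj-[-] T {u} {v} l)
  gdist-link (suc t) a {u} {v} l with linkView T {u = u} {v} l
  ... | at-head xy with adj⇒parentEdge a xy
  ...   | inj₁ (y≡1+x , refl) = sym (gdist-link-head t a _ y≡1+x)
  ...   | inj₂ (x≡1+y , refl) = gdist-link-head t a _ x≡1+y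
  gdist-link (suc t) a l | in-tail {x} l′ =
    cong (entryDist t a (dist a x) x +_) (gdist-link t (parent a x) l′)

  gparent-link : ∀ t a {u v : Word n (suc t)} → LinkAdj T u v →
                 Contracted T (gparent t a u) (gparent t a v)
  gparent-link zero a {u} {v} l = ⊥-elim (¬LinkAdj-[-] T {u} {v} l)
  gparent-link (suc t) a {u} {v} l with linkView T {u = u} {v} l
  ... | at-head xy with adj⇒parentEdge a xy
  ...   | inj₁ (y≡1+x , refl) = ≈-reflexive (sym (gparent-link-head t a _ y≡1+x))
  ...   | inj₂ (x≡1+y , refl) = ≈-reflexive (gparent-link-head t a _ x≡1+y)
  gparent-link (suc t) a l | in-tail {x} {u} {v} l′ =
    subst₂ (Contracted T) (sym (off-entry {u} {v} l′)) (sym (off-entry {v} {u} (LinkAdj-sym T {u = u} {v} l′)))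
      (∷-Contracted T x (gparent-link t (parent a x) l′))
    where
    off-entry : ∀ {u v} → LinkAdj T u v → gparent (suc t) a (x ∷ u) ≡ x ∷ gparent t (parent a x) u
    off-entry {u} {v} l = gparent-off-entry t a x (LinkAdj⇒≢replicate T {u = u} {v} l (parent a x))

  gdist-cong : ∀ t a {u v : Word n (suc t)} → Contracted T u v → gdist t a u ≡ gdist t a v
  gdist-cong t a = Star.fold (_≡_ on gdist t a) (λ l → trans (gdist-link t a l)) refl

  gparent-cong : ∀ t a {u v : Word n (suc t)} → Contracted T u v →
                 Contracted T (gparent t a u) (gparent t a v)
  gparent-cong t a = Star.fold (Contracted T on gparent t a) (λ l → gparent-link t a l ◅◅_) ε

  GParentEdge : ∀ t → Fin n → Word n (suc t) → Word n (suc t) → Set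
  GParentEdge t a = ParentEdge (Gasket T (suc t)) (gdist t a) (gparent t a)

  ∷-parentEdge : ∀ t a x {u v} → GParentEdge t (parent a x) u v →
                 GParentEdge (suc t) a (x ∷ u) (x ∷ v)
  ∷-parentEdge t a x {u} {v} (v≡1+u , u≈pv) =
    trans (cong (entryDist t a (dist a x) x +_) v≡1+u) (+-suc _ _) ,
    subst (Contracted T (x ∷ u)) (sym (gparent-off-entry t a x v≢entry)) (∷-Contracted T x u≈pv)
    where
    v≢entry : v ≢ replicate (suc t) (parent a x)
    v≢entry refl = 0≢1+n (trans (sym (gdist-root t (parent a x))) v≡1+u)

  last-parentEdge : ∀ t a {u v : Word n (suc t)} → SAdjAt T u v (fromℕ t) →
                    GParentEdge t a u v ⊎ GParentEdge t a v u
  last-parentEdge zero a {x ∷ []} {y ∷ []} s =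
    Sum.map singleton singleton (adj⇒parentEdge a (proj₁ (SAdjAt-head⁻ T {u = []} {[]} s)))
    where
    singleton : ∀ {x y} → ParentEdge (toSG T) (dist a) (parent a) x y →
                GParentEdge zero a (x ∷ []) (y ∷ [])
    singleton (y≡1+x , refl) = y≡1+x , ε
  last-parentEdge (suc t) a {x ∷ u} {y ∷ v} s with SAdjAt-∷⁻ T {u = u} {v} s
  ... | refl , s′ =
    Sum.map (∷-parentEdge t a x) (∷-parentEdge t a x) (last-parentEdge t (parent a x) s′)

  parentEdge-resp : ∀ t a {u u′ v v′} → Contracted T u u′ → Contracted T v v′ →
                    GParentEdge t a u′ v′ → GParentEdge t a u v
  parentEdge-resp t a u≈u′ v≈v′ (v′≡1+u′ , u′≈pv′) =
    trans (gdist-cong t a v≈v′) (trans v′≡1+u′ (cong suc (sym (gdist-cong t a u≈u′)))) ,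
    ≈-trans u≈u′ (≈-trans u′≈pv′ (≈-sym (gparent-cong t a v≈v′)))

  gasketLevelled : ∀ t → Fin n → Levelled (Gasket T (suc t))
  gasketLevelled t a = record
    { level = gdist t a
    ; parent = gparent t a
    ; level-cong = gdist-cong t a
    ; adj⇒parentEdge = adj⇒gparentEdge }
    where
    adj⇒gparentEdge : ∀ {u v} → GAdj T u v → GParentEdge t a u v ⊎ GParentEdge t a v u
    adj⇒gparentEdge (u≉v , u′ , v′ , u≈u′ , v≈v′ , s) with linking-or-last T {u = u′} {v′} s
    ... | inj₁ l = contradiction (≈-trans u≈u′ (l ◅ ≈-sym v≈v′)) u≉v
    ... | inj₂ s′ =
      Sum.map (parentEdge-resp t a u≈u′ v≈v′) (parentEdge-resp t a v≈v′ u≈u′) (last-parentEdge t a s′)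

  last⇒GAdj : ∀ t {u v : Word n (suc t)} → SAdjAt T u v (fromℕ t) → GAdj T u v
  last⇒GAdj t {u@(a ∷ _)} {v} s = u≉v , u , v , ε , ε , fromℕ t , s
    where
    u≉v : ¬ Contracted T u v
    u≉v u≈v with last-parentEdge t a s
    ... | inj₁ (v≡1+u , _) = 1+n≢n (trans (sym v≡1+u) (sym (gdist-cong t a u≈v)))
    ... | inj₂ (u≡1+v , _) = 1+n≢n (trans (sym u≡1+v) (gdist-cong t a u≈v))

  gasket-connected : ∀ t → Connected (Gasket T (suc t))
  gasket-connected t u v = Star.map step (Sierpinski-connected T conn (suc t) u v)
    where
    step : ∀ {u v} → u ≡ v ⊎ SAdj T u v → Contracted T u v ⊎ GAdj T u v
    step (inj₁ refl) = inj₁ ε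
    step {u} {v} (inj₂ s) = Sum.map (_◅ ε) (last⇒GAdj t) (linking-or-last T {u = u} {v} s)

  ∃-GAdj : ∀ t → ∃₂ (Adj T) → ∃₂ (GAdj T {suc t})
  ∃-GAdj t (_ , _ , xy) with ∃-last-SAdjAt T xy t
  ... | u , v , s = u , v , last⇒GAdj t s

mainTheorem15 : (n : ℕ) → 2 ≤ n → (T : Graph n) → IsTree (toSG T) →
    (t : ℕ) → 1 ≤ t → IsTree (Gasket T t) × ChromaticNumber (Gasket T t) 2
mainTheorem15 (suc (suc _)) (s≤s (s≤s _)) T (conn , acyc) (suc t) (s≤s _) =
  (gasket-connected t , Levelled⇒Acyclic _ levelled (Contracted-isEquivalence T)) ,
  χ≡2 _ (∃-GAdj t (walk⇒edge T (λ ()) (conn zero (suc zero)))) (Levelled⇒Colouring _ levelled)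
  where
  open GasketOfTree T conn acyc
  levelled : Levelled (Gasket T (suc t))
  levelled = gasketLevelled t zero
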